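{- Let $\ell\ge n\ge2$ and $1\le k\le n-1$ be integers, and let $\mathcal{S}_\ell(n,k)$ denote the set of permutations of $[\ell]$ with exactly $\ell-n$ fixed points and exactly $k$ exceedances. Then \[ |\mathcal{S}_\ell(n,k)|\leq\binom{\ell}{n}\cdot\theta(n,k),\qquad\text{where}\quad\theta(n,k):=\begin{cases}1 & \text{if } k=1\text{ or }k=n-1,\\ (2k+3)^n & \text{if } 2\leq k<n/2,\\ (2n-2k+5)^n & \text{if } n/2\leq k\leq n-2.\end{cases} \]
   Context: The number of exceedances of a permutation $\sigma$ of $[m]$ is $|\{i:\sigma(i)>i\}|$; a fixed point is an $i$ with $\sigma(i)=i$. -}

module Defs where

open import Data.Nat using (ℕ; _+_; _*_; _∸_; _^_; _≡ᵇ_; _<ᵇ_)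
open import Data.Nat.Properties using ()
open import Data.Bool using (Bool; if_then_else_; _∨_)
open import Data.Fin using (Fin; toℕ)
import Data.Fin.Properties as FinP
open import Data.Vec using (Vec; lookup)
open import Data.List using (List; length; filter)
open import Data.Fin.Base using ()
open import Data.List using ()
import Data.Nat.Properties as NatP
open import Relation.Binary.PropositionalEquality using (_≡_)
open import Function.Definitions using (Injective)

-- A permutation of [ℓ] = {0,…,ℓ-1}, in one-line notation: a vector whose
-- i-th entry is σ(i); it is a permutation iff i ↦ σ(i) is injective
-- (equivalently bijective, as the domain and codomain are both Fin ℓ).
IsPerm : ∀ {ℓ} → Vec (Fin ℓ) ℓ → Set
IsPerm σ = Injective _≡_ _≡_ (lookup σ)

allFin' : ∀ ℓ → List (Fin ℓ)
allFin' ℓ = Data.List.allFin ℓ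

fixedPoints : ∀ {ℓ} → Vec (Fin ℓ) ℓ → ℕ
fixedPoints {ℓ} σ = length (filter (λ i → lookup σ i FinP.≟ i) (allFin' ℓ))

exceedances : ∀ {ℓ} → Vec (Fin ℓ) ℓ → ℕ
exceedances {ℓ} σ = length (filter (λ i → toℕ i NatP.<? toℕ (lookup σ i)) (allFin' ℓ))

InS : (ℓ n k : ℕ) → Vec (Fin ℓ) ℓ → Set
InS ℓ n k σ = IsPerm σ × (fixedPoints σ ≡ ℓ ∸ n) × (exceedances σ ≡ k)
  where open import Data.Product using (_×_)

-- θ(n,k) (the three cases are disjoint and exhaustive for n ≥ 2, 1 ≤ k ≤ n-1):
--   1 if k = 1 or k = n-1; (2k+3)^n if 2 ≤ k < n/2 (i.e. 2k < n);
--   (2n-2k+5)^n if n/2 ≤ k ≤ n-2.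
θ : ℕ → ℕ → ℕ
θ n k = if (k ≡ᵇ 1) ∨ (k ≡ᵇ (n ∸ 1)) then 1
        else if (2 * k) <ᵇ n then (2 * k + 3) ^ n
        else (2 * n ∸ 2 * k + 5) ^ n

-- Deleting 0 from its cycle turns a permutation σ of [ℓ+1] into a permutation τ of [ℓ]
-- (values shifted down by one) together with, when σ(0) ≠ 0, the position j with σ(j+1) = 0,
-- and σ can be recovered from (τ, j).  Whether j is an exceedance, a deficiency or a fixed
-- point of τ determines how the numbers of fixed points and exceedances change, so the
-- permutations of [ℓ] with f fixed points and k exceedances number at most the solution
-- C(ℓ,f)·der(ℓ−f,k) of the resulting recurrence, where der n k counts the derangements of [n]
-- with k exceedances.  Finally der n 1 = der n (n−1) = 1, and induction on the recurrence of
-- der gives der n k ≤ (2k+3)^n and der n k ≤ (2(n−k)+3)^n, the step resting on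
-- 2(n+1)B^n ≤ (B+2)^(n+1).

module Submission where

open import Defs
open import Data.Bool using (Bool; true; false; if_then_else_; T)
open import Data.Empty using (⊥-elim)
open import Data.Fin using (Fin; zero; suc; toℕ; punchOut)
open import Data.Fin.Properties as FinP using (any?)
open import Data.List using (List; []; _∷_; [_]; length; map; filter; tabulate)
open import Data.List.Properties using (length-map)
open import Data.List.Relation.Unary.All as All using (All; []; _∷_; reduce)
open import Data.List.Relation.Unary.All.Properties using (all-filter; filter⁺)
open import Data.List.Relation.Unary.AllPairs using ([]; _∷_)
open import Data.List.Relation.Unary.Unique.Propositional using (Unique)
import Data.List.Relation.Unary.Unique.Propositional.Properties as Unique
open import Data.Nat using (ℕ; zero; suc; pred; _+_; _*_; _∸_; _^_; _≤_; _<_; z≤n; s≤s; s≤s⁻¹; _≡ᵇ_; _<ᵇ_)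
open import Data.Nat.Combinatorics using (_C_; nC1≡n; nCk+nC[k+1]≡[n+1]C[k+1]; nCk≡nC[n∸k])
open import Data.Nat.Combinatorics.Specification using (k>n⇒nCk≡0)
open import Data.Nat.Properties
open import Data.Nat.Tactic.RingSolver using (solve-∀)
open import Data.Product using (∃; _×_; _,_; proj₁; proj₂)
open import Data.Unit using (tt)
open import Data.Vec as Vec using (Vec; []; _∷_; lookup; _[_]≔_)
open import Data.Vec.Properties
  using (lookup-map; lookup∘update; lookup∘update′; lookup∘tabulate; tabulate∘lookup; tabulate-cong; ≡-dec)
open import Function using (_∘_; id; case_of_)
open import Function.Definitions using (Injective)
open import Level using (0ℓ)
open import Relation.Binary.Definitions using (DecidableEquality; tri<; tri≈; tri>)
open import Relation.Binary.PropositionalEquality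
  using (_≡_; _≢_; refl; sym; trans; cong; cong₂; subst; module ≡-Reasoning)
open import Relation.Nullary using (¬_; Dec; yes; no; does; contradiction)
open import Relation.Nullary.Decidable using (dec-true; dec-false)
open import Relation.Unary using (Pred; Decidable; _∩_; ∁; _⊆_)
open import Relation.Unary.Properties using (∁?)

private
  variable
    A B : Set
    m n : ℕ
    P Q : Pred A 0ℓ

-- Counting by duplicate-free lists

infix 4 ∣_∣≤_

∣_∣≤_ : Pred A 0ℓ → ℕ → Set
∣_∣≤_ {A} P n = (xs : List A) → Unique xs → All P xs → length xs ≤ n

∣∣≤-mono : Q ⊆ P → m ≤ n → ∣ P ∣≤ m → ∣ Q ∣≤ n
∣∣≤-mono Q⊆P m≤n bound xs unique qxs = ≤-trans (bound xs unique (All.map Q⊆P qxs)) m≤n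

∣∣≤-empty : (∀ {x} → ¬ P x) → ∣ P ∣≤ 0
∣∣≤-empty ¬P []      _ _         = z≤n
∣∣≤-empty ¬P (_ ∷ _) _ (px ∷ _) = contradiction px ¬P

∣∣≤-singleton : (a : A) → ∣ (_≡ a) ∣≤ 1
∣∣≤-singleton a []          _                  _               = z≤n
∣∣≤-singleton a (_ ∷ [])    _                  _               = s≤s z≤n
∣∣≤-singleton a (_ ∷ _ ∷ _) ((x≢y ∷ _) ∷ _) (refl ∷ refl ∷ _) = contradiction refl x≢y

length≡filter+filter∁ : (Q? : Decidable Q) (xs : List A) →
                        length xs ≡ length (filter Q? xs) + length (filter (∁? Q?) xs)
length≡filter+filter∁ Q? []       = refl
length≡filter+filter∁ Q? (x ∷ xs) with Q? x
... | yes _ = cong suc (length≡filter+filter∁ Q? xs)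
... | no  _ = trans (cong suc (length≡filter+filter∁ Q? xs)) (sym (+-suc _ _))

∣∣≤-split : Decidable Q → ∣ P ∩ Q ∣≤ m → ∣ P ∩ ∁ Q ∣≤ n → ∣ P ∣≤ m + n
∣∣≤-split {P = P} Q? boundQ bound∁Q xs unique pxs =
  subst (_≤ _) (sym (length≡filter+filter∁ Q? xs)) (+-mono-≤ (part Q? boundQ) (part (∁? Q?) bound∁Q))
  where
  part : ∀ {R : Pred _ 0ℓ} {k} (R? : Decidable R) → ∣ P ∩ R ∣≤ k → length (filter R? xs) ≤ k
  part R? bound = bound _ (Unique.filter⁺ R? unique) (All.zip (filter⁺ R? pxs , all-filter R? xs))

∣∣≤-encode : {Q : Pred B 0ℓ} (encode : ∀ {x} → P x → B) (decode : B → A) →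
             (∀ {x} (px : P x) → decode (encode px) ≡ x) → (∀ {x} (px : P x) → Q (encode px)) →
             ∣ Q ∣≤ n → ∣ P ∣≤ n
∣∣≤-encode {B = B} {P = P} {Q = Q} encode decode decode∘encode encode∈Q boundQ xs unique pxs =
  subst (_≤ _) length-codes (boundQ codes (Unique.map⁻ (subst Unique (sym (decode-codes pxs)) unique)) (codes∈Q pxs))
  where
  codes : List B
  codes = reduce encode pxs
  decode-codes : ∀ {ys} (pys : All P ys) → map decode (reduce encode pys) ≡ ys
  decode-codes []         = refl
  decode-codes (py ∷ pys) = cong₂ _∷_ (decode∘encode py) (decode-codes pys)
  codes∈Q : ∀ {ys} (pys : All P ys) → All Q (reduce encode pys)
  codes∈Q []         = []
  codes∈Q (py ∷ pys) = encode∈Q py ∷ codes∈Q pys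
  length-codes : length codes ≡ length xs
  length-codes = trans (sym (length-map decode codes)) (cong length (decode-codes pxs))

∣∣≤-remove : {a : A} → P a → ∣ P ∣≤ suc n → ∣ P ∩ ∁ (_≡ a) ∣≤ n
∣∣≤-remove pa bound xs unique pxs =
  s≤s⁻¹ (bound (_ ∷ xs) (All.map (λ (_ , x≢a) a≡x → x≢a (sym a≡x)) pxs ∷ unique) (pa ∷ All.map proj₁ pxs))

∣∣≤-× : {Q : A → Pred B 0ℓ} → DecidableEquality A → ∣ P ∣≤ m → (∀ {a} → P a → ∣ Q a ∣≤ n) →
        ∣ (λ ((a , c) : A × B) → P a × Q a c) ∣≤ m * n
∣∣≤-× _≟_ boundP boundQ [] _ _ = z≤n
∣∣≤-× {m = zero} _≟_ boundP boundQ ((a , _) ∷ _) _ ((pa , _) ∷ _) =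
  contradiction (boundP [ a ] ([] ∷ []) (pa ∷ [])) λ ()
∣∣≤-× {P = P} {m = suc m} {n = n} {Q = Q} _≟_ boundP boundQ ps@((a , _) ∷ _) unique pqs@((pa , _) ∷ _) =
  ∣∣≤-split (λ (x , _) → x ≟ a) first-is-a first-is-not-a ps unique pqs
  where
  first-is-a : ∣ (λ (x , c) → P x × Q x c) ∩ (λ (x , _) → x ≡ a) ∣≤ n
  first-is-a = ∣∣≤-encode (λ {(_ , c)} _ → c) (a ,_) (λ { (_ , refl) → refl }) (λ { ((_ , qc) , refl) → qc })
                          (boundQ pa)
  first-is-not-a : ∣ (λ (x , c) → P x × Q x c) ∩ ∁ (λ (x , _) → x ≡ a) ∣≤ m * n
  first-is-not-a = ∣∣≤-mono (λ ((px , qc) , x≢a) → (px , x≢a) , qc) ≤-refl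
                            (∣∣≤-× _≟_ (∣∣≤-remove pa boundP) (λ (px , _) → boundQ px))

ind : Bool → ℕ
ind b = if b then 1 else 0

count : (Fin n → Bool) → ℕ
count {zero}  p = 0
count {suc n} p = ind (p zero) + count (λ i → p (suc i))

count-cong : {p q : Fin n → Bool} → (∀ i → p i ≡ q i) → count p ≡ count q
count-cong {zero}  p≗q = refl
count-cong {suc n} p≗q = cong₂ _+_ (cong ind (p≗q zero)) (count-cong (λ i → p≗q (suc i)))

count-update : (p q : Fin n → Bool) (j : Fin n) → (∀ i → i ≢ j → p i ≡ q i) →
               count p + ind (q j) ≡ count q + ind (p j)
count-update {suc n} p q zero agree
  rewrite count-cong {p = λ i → p (suc i)} {q = λ i → q (suc i)} (λ i → agree (suc i) λ ()) =
  swap (ind (p zero)) (count (λ i → q (suc i))) (ind (q zero))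
  where
  swap : ∀ a c b → a + c + b ≡ b + c + a
  swap = solve-∀
count-update {suc n} p q (suc j) agree = begin
  ind (p zero) + count (λ i → p (suc i)) + ind (q (suc j))
    ≡⟨ +-assoc (ind (p zero)) _ _ ⟩
  ind (p zero) + (count (λ i → p (suc i)) + ind (q (suc j)))
    ≡⟨ cong₂ _+_ (cong ind (agree zero λ ()))
         (count-update (λ i → p (suc i)) (λ i → q (suc i)) j (λ i i≢j → agree (suc i) (i≢j ∘ FinP.suc-injective))) ⟩
  ind (q zero) + (count (λ i → q (suc i)) + ind (p (suc j)))
    ≡⟨ +-assoc (ind (q zero)) _ _ ⟨
  ind (q zero) + count (λ i → q (suc i)) + ind (p (suc j))
    ∎
  where open ≡-Reasoning

count-partition : (p q r : Fin n → Bool) → (∀ i → ind (p i) + ind (q i) + ind (r i) ≡ 1) →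
                  count p + count q + count r ≡ n
count-partition {zero}  p q r exactly-one = refl
count-partition {suc n} p q r exactly-one = begin
  ind (p zero) + count (p ∘ suc) + (ind (q zero) + count (q ∘ suc)) + (ind (r zero) + count (r ∘ suc))
    ≡⟨ regroup (ind (p zero)) (ind (q zero)) (ind (r zero)) (count (p ∘ suc)) (count (q ∘ suc)) (count (r ∘ suc)) ⟩
  ind (p zero) + ind (q zero) + ind (r zero) + (count (p ∘ suc) + count (q ∘ suc) + count (r ∘ suc))
    ≡⟨ cong₂ _+_ (exactly-one zero) (count-partition (p ∘ suc) (q ∘ suc) (r ∘ suc) (exactly-one ∘ suc)) ⟩
  suc n
    ∎
  where
  open ≡-Reasoning
  regroup : ∀ a b c x y z → a + x + (b + y) + (c + z) ≡ a + b + c + (x + y + z)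
  regroup = solve-∀

count-filter : (P? : Decidable P) (f : Fin n → A) →
               length (filter P? (tabulate f)) ≡ count (λ i → does (P? (f i)))
count-filter {n = zero}  P? f = refl
count-filter {n = suc n} P? f with does (P? (f zero))
... | true  = cong suc (count-filter P? (f ∘ suc))
... | false = count-filter P? (f ∘ suc)

∣∣≤-count : {P : Pred (Fin n) 0ℓ} (P? : Decidable P) → ∣ P ∣≤ count (λ i → does (P? i))
∣∣≤-count {n = zero}  P? = ∣∣≤-empty λ { {()} }
∣∣≤-count {n = suc n} {P = P} P? = ∣∣≤-split (FinP._≟ zero) at-zero elsewhere
  where
  at-zero : ∣ P ∩ (_≡ zero) ∣≤ ind (does (P? zero))
  at-zero with P? zero
  ... | yes _  = ∣∣≤-mono proj₂ ≤-refl (∣∣≤-singleton zero)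
  ... | no ¬p0 = ∣∣≤-empty λ { (p0 , refl) → ¬p0 p0 }
  predecessor : ∀ {i} → P i × i ≢ zero → Fin n
  predecessor {zero}  (_ , i≢0) = ⊥-elim (i≢0 refl)
  predecessor {suc i} _         = i
  elsewhere : ∣ P ∩ ∁ (_≡ zero) ∣≤ count (λ i → does (P? (suc i)))
  elsewhere = ∣∣≤-encode predecessor suc
    (λ { {zero} (_ , i≢0) → ⊥-elim (i≢0 refl) ; {suc i} _ → refl })
    (λ { {zero} (_ , i≢0) → ⊥-elim (i≢0 refl) ; {suc i} (p , _) → p })
    (∣∣≤-count (λ i → P? (suc i)))

fixedAt exceedsAt deficientAt : Fin n → Fin n → Bool
fixedAt     i v = does (v FinP.≟ i)
exceedsAt   i v = does (toℕ i <? toℕ v)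
deficientAt i v = does (toℕ v <? toℕ i)

countAt : (Fin n → Fin n → Bool) → Vec (Fin n) n → ℕ
countAt R σ = count (λ i → R i (lookup σ i))

fixedPoints≡countAt : (σ : Vec (Fin n) n) → fixedPoints σ ≡ countAt fixedAt σ
fixedPoints≡countAt σ = count-filter (λ i → lookup σ i FinP.≟ i) (λ i → i)

exceedances≡countAt : (σ : Vec (Fin n) n) → exceedances σ ≡ countAt exceedsAt σ
exceedances≡countAt σ = count-filter (λ i → toℕ i <? toℕ (lookup σ i)) (λ i → i)

exactly-one-class : (i v : Fin n) → ind (fixedAt i v) + ind (exceedsAt i v) + ind (deficientAt i v) ≡ 1
exactly-one-class i v with <-cmp (toℕ i) (toℕ v)
... | tri< i<v i≢v _ rewrite dec-false (v FinP.≟ i) (i≢v ∘ cong toℕ ∘ sym) | dec-true (toℕ i <? toℕ v) i<v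
                           | dec-false (toℕ v <? toℕ i) (<-asym i<v) = refl
... | tri≈ _ i≡v _   rewrite dec-true (v FinP.≟ i) (sym (FinP.toℕ-injective i≡v))
                           | dec-false (toℕ i <? toℕ v) (<-irrefl i≡v)
                           | dec-false (toℕ v <? toℕ i) (<-irrefl (sym i≡v)) = refl
... | tri> _ i≢v v<i rewrite dec-false (v FinP.≟ i) (i≢v ∘ cong toℕ ∘ sym) | dec-false (toℕ i <? toℕ v) (<-asym v<i)
                           | dec-true (toℕ v <? toℕ i) v<i = refl

fixedPoints+exceedances+deficiencies : (σ : Vec (Fin n) n) →
                                       fixedPoints σ + exceedances σ + countAt deficientAt σ ≡ n
fixedPoints+exceedances+deficiencies σ
  rewrite fixedPoints≡countAt σ | exceedances≡countAt σ =
  count-partition _ _ _ (λ i → exactly-one-class i (lookup σ i))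

deficiencies≡n∸f∸k : ∀ {f k} (τ : Vec (Fin n) n) → fixedPoints τ ≡ f → exceedances τ ≡ k →
                     countAt deficientAt τ ≡ n ∸ f ∸ k
deficiencies≡n∸f∸k {n} {f} {k} τ refl refl = begin
  countAt deficientAt τ          ≡⟨ m+n∸m≡n (f + k) _ ⟨
  f + k + countAt deficientAt τ ∸ (f + k)  ≡⟨ cong (_∸ (f + k)) (fixedPoints+exceedances+deficiencies τ) ⟩
  n ∸ (f + k)                    ≡⟨ ∸-+-assoc n f k ⟨
  n ∸ f ∸ k                      ∎
  where open ≡-Reasoning

PermWith : ℕ → ℕ → Vec (Fin n) n → Set
PermWith f k σ = IsPerm σ × fixedPoints σ ≡ f × exceedances σ ≡ k

-- Deleting 0 from its cycle

lookup-extensionality : {u w : Vec A n} → (∀ i → lookup u i ≡ lookup w i) → u ≡ w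
lookup-extensionality {u = u} {w} u≗w =
  trans (sym (tabulate∘lookup u)) (trans (tabulate-cong u≗w) (tabulate∘lookup w))

injective⇒surjective : {s : Fin n → Fin n} → Injective _≡_ _≡_ s → ∀ y → ∃ λ x → s x ≡ y
injective⇒surjective {suc n} {s} s-inj y with any? (λ x → s x FinP.≟ y)
... | yes hit = hit
... | no  miss = contradiction (FinP.injective⇒≤ punchOut-injective) 1+n≰n
  where
  avoids : ∀ x → y ≢ s x
  avoids x y≡sx = miss (x , sym y≡sx)
  punchOut-injective : Injective _≡_ _≡_ (λ x → punchOut (avoids x))
  punchOut-injective e = s-inj (FinP.punchOut-injective (avoids _) (avoids _) e)

-- lift₀ τ adds 0 as a new fixed point; insertAfter j τ inserts 0 into the cycle of τ right
-- after j, i.e. j+1 ↦ 0 ↦ τ(j)+1.  Both shift the values of τ up by one.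
lift₀ : Vec (Fin n) n → Vec (Fin (suc n)) (suc n)
lift₀ τ = zero ∷ Vec.map suc τ

insertAfter : Fin n → Vec (Fin n) n → Vec (Fin (suc n)) (suc n)
insertAfter j τ = suc (lookup τ j) ∷ (Vec.map suc τ [ j ]≔ zero)

lookup-insertAfter-≢ : ∀ {i j} (τ : Vec (Fin n) n) → i ≢ j → lookup (insertAfter j τ) (suc i) ≡ suc (lookup τ i)
lookup-insertAfter-≢ {i = i} τ i≢j = trans (lookup∘update′ i≢j (Vec.map suc τ) zero) (lookup-map i suc τ)

lookup-insertAfter-≡ : ∀ j (τ : Vec (Fin n) n) → lookup (insertAfter j τ) (suc j) ≡ zero
lookup-insertAfter-≡ j τ = lookup∘update j (Vec.map suc τ) zero

IsPerm-lift₀⁻ : {τ : Vec (Fin n) n} → IsPerm (lift₀ τ) → IsPerm τ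
IsPerm-lift₀⁻ {τ = τ} perm {a} {b} τa≡τb =
  FinP.suc-injective (perm {suc a} {suc b}
    (trans (lookup-map a suc τ) (trans (cong suc τa≡τb) (sym (lookup-map b suc τ)))))

IsPerm-insertAfter⁻ : ∀ {j} {τ : Vec (Fin n) n} → IsPerm (insertAfter j τ) → IsPerm τ
IsPerm-insertAfter⁻ {j = j} {τ} perm {a} {b} τa≡τb with a FinP.≟ j | b FinP.≟ j
... | yes refl | yes refl = refl
... | yes refl | no b≢j   =
  contradiction (perm {zero} {suc b} (trans (cong suc τa≡τb) (sym (lookup-insertAfter-≢ τ b≢j)))) λ ()
... | no a≢j   | yes refl =
  contradiction (perm {suc a} {zero} (trans (lookup-insertAfter-≢ τ a≢j) (cong suc τa≡τb))) λ ()
... | no a≢j   | no b≢j   =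
  FinP.suc-injective (perm {suc a} {suc b}
    (trans (lookup-insertAfter-≢ τ a≢j) (trans (cong suc τa≡τb) (sym (lookup-insertAfter-≢ τ b≢j)))))

-- The value σ(i+1) − 1, where the 0 in the image of σ is read as σ(0); the last clause is
-- reached only if σ is not injective.
bypass₀ : Fin (suc n) → Fin (suc n) → Fin n → Fin n
bypass₀ (suc v) _       _ = v
bypass₀ zero    (suc w) _ = w
bypass₀ zero    zero    i = i

delete₀ : Vec (Fin (suc n)) (suc n) → Vec (Fin n) n
delete₀ σ = Vec.tabulate (λ i → bypass₀ (lookup σ (suc i)) (lookup σ zero) i)

suc-lookup-delete₀ : (σ : Vec (Fin (suc n)) (suc n)) (i : Fin n) →
                     lookup σ (suc i) ≢ zero → suc (lookup (delete₀ σ) i) ≡ lookup σ (suc i)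
suc-lookup-delete₀ σ i σi≢0 rewrite lookup∘tabulate (λ i → bypass₀ (lookup σ (suc i)) (lookup σ zero) i) i
  with lookup σ (suc i)
... | suc _ = refl
... | zero  = contradiction refl σi≢0

suc-lookup-delete₀-bypass : (σ : Vec (Fin (suc n)) (suc n)) (i : Fin n) →
                            lookup σ (suc i) ≡ zero → lookup σ zero ≢ zero →
                            suc (lookup (delete₀ σ) i) ≡ lookup σ zero
suc-lookup-delete₀-bypass σ i σi≡0 σ0≢0 rewrite lookup∘tabulate (λ i → bypass₀ (lookup σ (suc i)) (lookup σ zero) i) i
  | σi≡0 with lookup σ zero
... | suc _ = refl
... | zero  = contradiction refl σ0≢0

lift₀-delete₀ : (σ : Vec (Fin (suc n)) (suc n)) → IsPerm σ → lookup σ zero ≡ zero → lift₀ (delete₀ σ) ≡ σ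
lift₀-delete₀ σ perm σ0≡0 = lookup-extensionality λ where
  zero    → sym σ0≡0
  (suc i) → trans (lookup-map i suc (delete₀ σ))
                  (suc-lookup-delete₀ σ i λ σi≡0 → contradiction (perm (trans σi≡0 (sym σ0≡0))) λ ())

insertAfter-delete₀ : (σ : Vec (Fin (suc n)) (suc n)) {j : Fin n} →
                      IsPerm σ → lookup σ (suc j) ≡ zero → insertAfter j (delete₀ σ) ≡ σ
insertAfter-delete₀ σ {j} perm σj≡0 = lookup-extensionality λ where
  zero    → suc-lookup-delete₀-bypass σ j σj≡0 λ σ0≡0 → contradiction (perm (trans σ0≡0 (sym σj≡0))) λ ()
  (suc i) → case i FinP.≟ j of λ where
    (yes refl) → trans (lookup-insertAfter-≡ i (delete₀ σ)) (sym σj≡0)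
    (no i≢j)   → trans (lookup-insertAfter-≢ (delete₀ σ) i≢j)
                       (suc-lookup-delete₀ σ i λ σi≡0 → i≢j (FinP.suc-injective (perm (trans σi≡0 (sym σj≡0)))))

zero-preimage : (σ : Vec (Fin (suc n)) (suc n)) → IsPerm σ → lookup σ zero ≢ zero →
                ∃ λ j → lookup σ (suc j) ≡ zero
zero-preimage σ perm σ0≢0 with injective⇒surjective perm zero
... | zero  , σ0≡0 = contradiction σ0≡0 σ0≢0
... | suc j , σj≡0 = j , σj≡0

module _ (R : ∀ {n} → Fin n → Fin n → Bool) (R-shift : ∀ {n} (i v : Fin n) → R (suc i) (suc v) ≡ R i v) where

  countAt-lift₀ : (τ : Vec (Fin n) n) → countAt R (lift₀ τ) ≡ ind (R zero zero) + countAt R τ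
  countAt-lift₀ τ = cong (ind (R zero zero) +_)
    (count-cong λ i → trans (cong (R (suc i)) (lookup-map i suc τ)) (R-shift i (lookup τ i)))

  countAt-insertAfter : ∀ j (τ : Vec (Fin n) n) →
    countAt R (insertAfter j τ) + ind (R j (lookup τ j)) ≡
    ind (R zero (suc (lookup τ j))) + (countAt R τ + ind (R (suc j) zero))
  countAt-insertAfter j τ = begin
    ind (R zero (suc (lookup τ j))) + count shifted + ind (R j (lookup τ j))
      ≡⟨ +-assoc (ind (R zero (suc (lookup τ j)))) _ _ ⟩
    ind (R zero (suc (lookup τ j))) + (count shifted + ind (R j (lookup τ j)))
      ≡⟨ cong (ind (R zero (suc (lookup τ j))) +_) (count-update shifted (λ i → R i (lookup τ i)) j agree) ⟩
    ind (R zero (suc (lookup τ j))) + (countAt R τ + ind (R (suc j) (lookup (insertAfter j τ) (suc j))))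
      ≡⟨ cong (λ v → ind (R zero (suc (lookup τ j))) + (countAt R τ + ind (R (suc j) v))) (lookup-insertAfter-≡ j τ) ⟩
    ind (R zero (suc (lookup τ j))) + (countAt R τ + ind (R (suc j) zero))
      ∎
    where
    open ≡-Reasoning
    shifted : Fin _ → Bool
    shifted i = R (suc i) (lookup (insertAfter j τ) (suc i))
    agree : ∀ i → i ≢ j → shifted i ≡ R i (lookup τ i)
    agree i i≢j = trans (cong (R (suc i)) (lookup-insertAfter-≢ τ i≢j)) (R-shift i (lookup τ i))

fixedPoints-lift₀ : (τ : Vec (Fin n) n) → fixedPoints (lift₀ τ) ≡ suc (fixedPoints τ)
fixedPoints-lift₀ τ = begin
  fixedPoints (lift₀ τ)        ≡⟨ fixedPoints≡countAt (lift₀ τ) ⟩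
  countAt fixedAt (lift₀ τ)    ≡⟨ countAt-lift₀ fixedAt (λ _ _ → refl) τ ⟩
  suc (countAt fixedAt τ)      ≡⟨ cong suc (fixedPoints≡countAt τ) ⟨
  suc (fixedPoints τ)          ∎
  where open ≡-Reasoning

exceedances-lift₀ : (τ : Vec (Fin n) n) → exceedances (lift₀ τ) ≡ exceedances τ
exceedances-lift₀ τ = begin
  exceedances (lift₀ τ)        ≡⟨ exceedances≡countAt (lift₀ τ) ⟩
  countAt exceedsAt (lift₀ τ)  ≡⟨ countAt-lift₀ exceedsAt (λ _ _ → refl) τ ⟩
  countAt exceedsAt τ          ≡⟨ exceedances≡countAt τ ⟨
  exceedances τ                ∎
  where open ≡-Reasoning

fixedPoints-insertAfter : ∀ j (τ : Vec (Fin n) n) →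
                          fixedPoints (insertAfter j τ) + ind (fixedAt j (lookup τ j)) ≡ fixedPoints τ
fixedPoints-insertAfter j τ = begin
  fixedPoints (insertAfter j τ) + ind (fixedAt j (lookup τ j))
    ≡⟨ cong (_+ ind (fixedAt j (lookup τ j))) (fixedPoints≡countAt (insertAfter j τ)) ⟩
  countAt fixedAt (insertAfter j τ) + ind (fixedAt j (lookup τ j))
    ≡⟨ countAt-insertAfter fixedAt (λ _ _ → refl) j τ ⟩
  countAt fixedAt τ + 0
    ≡⟨ +-identityʳ _ ⟩
  countAt fixedAt τ
    ≡⟨ fixedPoints≡countAt τ ⟨
  fixedPoints τ
    ∎
  where open ≡-Reasoning

exceedances-insertAfter : ∀ j (τ : Vec (Fin n) n) →
                          exceedances (insertAfter j τ) + ind (exceedsAt j (lookup τ j)) ≡ suc (exceedances τ)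
exceedances-insertAfter j τ = begin
  exceedances (insertAfter j τ) + ind (exceedsAt j (lookup τ j))
    ≡⟨ cong (_+ ind (exceedsAt j (lookup τ j))) (exceedances≡countAt (insertAfter j τ)) ⟩
  countAt exceedsAt (insertAfter j τ) + ind (exceedsAt j (lookup τ j))
    ≡⟨ countAt-insertAfter exceedsAt (λ _ _ → refl) j τ ⟩
  suc (countAt exceedsAt τ + 0)
    ≡⟨ cong suc (+-identityʳ _) ⟩
  suc (countAt exceedsAt τ)
    ≡⟨ cong suc (exceedances≡countAt τ) ⟨
  suc (exceedances τ)
    ∎
  where open ≡-Reasoning

exceedances-insertAfter-nonzero : ∀ j (τ : Vec (Fin n) n) → exceedances (insertAfter j τ) ≢ 0
exceedances-insertAfter-nonzero j τ exc≡0 = 0≢1+n (trans (sym exc≡0) (exceedances≡countAt (insertAfter j τ)))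

PermWith-lift₀⁻ : ∀ {f k} {τ : Vec (Fin n) n} → PermWith (suc f) k (lift₀ τ) → PermWith f k τ
PermWith-lift₀⁻ {τ = τ} (perm , fix , exc) =
  IsPerm-lift₀⁻ perm , suc-injective (trans (sym (fixedPoints-lift₀ τ)) fix) , trans (sym (exceedances-lift₀ τ)) exc

statistics-insertAfter⁻ : ∀ {f k} j (τ : Vec (Fin n) n) → PermWith f k (insertAfter j τ) →
                          fixedPoints τ ≡ f + ind (fixedAt j (lookup τ j)) ×
                          suc (exceedances τ) ≡ k + ind (exceedsAt j (lookup τ j))
statistics-insertAfter⁻ j τ (_ , fix , exc) =
  trans (sym (fixedPoints-insertAfter j τ)) (cong (_+ _) fix) ,
  trans (sym (exceedances-insertAfter j τ)) (cong (_+ _) exc)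

module _ {f k : ℕ} {j : Fin n} {τ : Vec (Fin n) n} where

  PermWith-insertAfter-exceeding⁻ : toℕ j < toℕ (lookup τ j) → PermWith f k (insertAfter j τ) → PermWith f k τ
  PermWith-insertAfter-exceeding⁻ j<τj σ∈@(perm , _) with fix , exc ← statistics-insertAfter⁻ j τ σ∈ =
    IsPerm-insertAfter⁻ perm ,
    trans fix (trans (cong (λ b → f + ind b) unfixed) (+-identityʳ f)) ,
    suc-injective (trans exc (trans (cong (λ b → k + ind b) exceeding) (+-comm k 1)))
    where
    unfixed : fixedAt j (lookup τ j) ≡ false
    unfixed = dec-false (lookup τ j FinP.≟ j) λ τj≡j → <-irrefl (cong toℕ (sym τj≡j)) j<τj
    exceeding : exceedsAt j (lookup τ j) ≡ true
    exceeding = dec-true (toℕ j <? toℕ (lookup τ j)) j<τj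

  PermWith-insertAfter-deficient⁻ : toℕ (lookup τ j) < toℕ j → PermWith f (suc k) (insertAfter j τ) → PermWith f k τ
  PermWith-insertAfter-deficient⁻ τj<j σ∈@(perm , _) with fix , exc ← statistics-insertAfter⁻ j τ σ∈ =
    IsPerm-insertAfter⁻ perm ,
    trans fix (trans (cong (λ b → f + ind b) unfixed) (+-identityʳ f)) ,
    suc-injective (trans exc (trans (cong (λ b → suc k + ind b) non-exceeding) (+-identityʳ (suc k))))
    where
    unfixed : fixedAt j (lookup τ j) ≡ false
    unfixed = dec-false (lookup τ j FinP.≟ j) λ τj≡j → <-irrefl (cong toℕ τj≡j) τj<j
    non-exceeding : exceedsAt j (lookup τ j) ≡ false
    non-exceeding = dec-false (toℕ j <? toℕ (lookup τ j)) (<-asym τj<j)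

  PermWith-insertAfter-fixed⁻ : lookup τ j ≡ j → PermWith f (suc k) (insertAfter j τ) → PermWith (suc f) k τ
  PermWith-insertAfter-fixed⁻ τj≡j σ∈@(perm , _) with fix , exc ← statistics-insertAfter⁻ j τ σ∈ =
    IsPerm-insertAfter⁻ perm ,
    trans fix (trans (cong (λ b → f + ind b) (dec-true (lookup τ j FinP.≟ j) τj≡j)) (+-comm f 1)) ,
    suc-injective (trans exc (trans (cong (λ b → suc k + ind b) non-exceeding) (+-identityʳ (suc k))))
    where
    non-exceeding : exceedsAt j (lookup τ j) ≡ false
    non-exceeding = dec-false (toℕ j <? toℕ (lookup τ j)) (<-irrefl (cong toℕ (sym τj≡j)))

-- If b f k bounds the permutations of [ℓ] with f fixed points and k exceedances, these bound
-- the permutations σ of [ℓ+1] with σ(0) = 0, resp. σ(0) ≠ 0; writing σ = insertAfter j τ in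
-- the latter case, the three summands are the cases that j is an exceedance, a deficiency or
-- a fixed point of τ.
fixesZeroBound : (ℕ → ℕ → ℕ) → ℕ → ℕ → ℕ
fixesZeroBound b zero    k = 0
fixesZeroBound b (suc f) k = b f k

movesZeroBound : ℕ → (ℕ → ℕ → ℕ) → ℕ → ℕ → ℕ
movesZeroBound ℓ b f zero    = 0
movesZeroBound ℓ b f (suc k) = b f (suc k) * suc k + (b f k * (ℓ ∸ f ∸ k) + b (suc f) k * suc f)

module DeleteZero {ℓ : ℕ} (b : ℕ → ℕ → ℕ) (bound : ∀ f k → ∣ PermWith {ℓ} f k ∣≤ b f k) where

  Inserted : ℕ → ℕ → Vec (Fin ℓ) ℓ × Fin ℓ → Set
  Inserted f k (τ , j) = PermWith f k (insertAfter j τ)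

  lifted : ∀ f k → ∣ (λ (τ : Vec (Fin ℓ) ℓ) → PermWith f k (lift₀ τ)) ∣≤ fixesZeroBound b f k
  lifted zero    k = ∣∣≤-empty λ { {τ} (_ , fix , _) → 0≢1+n (trans (sym fix) (fixedPoints-lift₀ τ)) }
  lifted (suc f) k = ∣∣≤-mono PermWith-lift₀⁻ ≤-refl (bound f k)

  Exceeding Deficient : Vec (Fin ℓ) ℓ × Fin ℓ → Set
  Exceeding (τ , j) = toℕ j < toℕ (lookup τ j)
  Deficient (τ , j) = toℕ (lookup τ j) < toℕ j

  inserted : ∀ f k → ∣ Inserted f k ∣≤ movesZeroBound ℓ b f k
  inserted f zero    = ∣∣≤-empty λ { {τ , j} (_ , _ , exc) → exceedances-insertAfter-nonzero j τ exc }
  inserted f (suc k) =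
    ∣∣≤-split (λ (τ , j) → toℕ j <? toℕ (lookup τ j)) exceeding
      (∣∣≤-split (λ (τ , j) → toℕ (lookup τ j) <? toℕ j) deficient fixed)
    where
    exceeding : ∣ Inserted f (suc k) ∩ Exceeding ∣≤ b f (suc k) * suc k
    exceeding = ∣∣≤-mono (λ (σ∈ , j<τj) → PermWith-insertAfter-exceeding⁻ j<τj σ∈ , j<τj) ≤-refl
      (∣∣≤-× (≡-dec FinP._≟_) (bound f (suc k)) λ { {τ} (_ , _ , exc) →
        ∣∣≤-mono id (≤-reflexive (trans (sym (exceedances≡countAt τ)) exc))
                 (∣∣≤-count (λ j → toℕ j <? toℕ (lookup τ j))) })
    deficient : ∣ (Inserted f (suc k) ∩ ∁ Exceeding) ∩ Deficient ∣≤ b f k * (ℓ ∸ f ∸ k)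
    deficient = ∣∣≤-mono (λ ((σ∈ , _) , τj<j) → PermWith-insertAfter-deficient⁻ τj<j σ∈ , τj<j) ≤-refl
      (∣∣≤-× (≡-dec FinP._≟_) (bound f k) λ { {τ} (_ , fix , exc) →
        ∣∣≤-mono id (≤-reflexive (deficiencies≡n∸f∸k τ fix exc))
                 (∣∣≤-count (λ j → toℕ (lookup τ j) <? toℕ j)) })
    fixed : ∣ (Inserted f (suc k) ∩ ∁ Exceeding) ∩ ∁ Deficient ∣≤ b (suc f) k * suc f
    fixed = ∣∣≤-mono (λ ((σ∈ , ¬exceeds) , ¬deficient) →
                        let τj≡j = FinP.toℕ-injective (≤-antisym (≮⇒≥ ¬exceeds) (≮⇒≥ ¬deficient))
                        in PermWith-insertAfter-fixed⁻ τj≡j σ∈ , τj≡j) ≤-refl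
      (∣∣≤-× (≡-dec FinP._≟_) (bound (suc f) k) λ { {τ} (_ , fix , _) →
        ∣∣≤-mono id (≤-reflexive (trans (sym (fixedPoints≡countAt τ)) fix))
                 (∣∣≤-count (λ j → lookup τ j FinP.≟ j)) })

  deletion-step : ∀ f k → ∣ PermWith {suc ℓ} f k ∣≤ fixesZeroBound b f k + movesZeroBound ℓ b f k
  deletion-step f k = ∣∣≤-split (λ σ → lookup σ zero FinP.≟ zero)
    (∣∣≤-encode (λ {σ} _ → delete₀ σ) lift₀ (λ {σ} → lift₀-delete₀′ {σ}) (λ {σ} → lifted-delete₀ {σ}) (lifted f k))
    (∣∣≤-encode (λ {σ} σ∈ → delete₀ σ , proj₁ (preimage {σ} σ∈)) (λ (τ , j) → insertAfter j τ)
      (λ {σ} → insertAfter-delete₀′ {σ}) (λ {σ} → inserted-delete₀ {σ}) (inserted f k))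
    where
    FixesZero MovesZero : Vec (Fin (suc ℓ)) (suc ℓ) → Set
    FixesZero = PermWith f k ∩ (λ σ → lookup σ zero ≡ zero)
    MovesZero = PermWith f k ∩ ∁ (λ σ → lookup σ zero ≡ zero)

    lift₀-delete₀′ : ∀ {σ} → FixesZero σ → lift₀ (delete₀ σ) ≡ σ
    lift₀-delete₀′ {σ} ((perm , _) , σ0≡0) = lift₀-delete₀ σ perm σ0≡0
    lifted-delete₀ : ∀ {σ} → FixesZero σ → PermWith f k (lift₀ (delete₀ σ))
    lifted-delete₀ {σ} σ∈@(σ∈′ , _) = subst (PermWith f k) (sym (lift₀-delete₀′ {σ} σ∈)) σ∈′

    preimage : ∀ {σ} → MovesZero σ → ∃ λ j → lookup σ (suc j) ≡ zero
    preimage {σ} ((perm , _) , σ0≢0) = zero-preimage σ perm σ0≢0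
    insertAfter-delete₀′ : ∀ {σ} (σ∈ : MovesZero σ) → insertAfter (proj₁ (preimage {σ} σ∈)) (delete₀ σ) ≡ σ
    insertAfter-delete₀′ {σ} σ∈@((perm , _) , _) = insertAfter-delete₀ σ perm (proj₂ (preimage {σ} σ∈))
    inserted-delete₀ : ∀ {σ} (σ∈ : MovesZero σ) → Inserted f k (delete₀ σ , proj₁ (preimage {σ} σ∈))
    inserted-delete₀ {σ} σ∈@(σ∈′ , _) = subst (PermWith f k) (sym (insertAfter-delete₀′ {σ} σ∈)) σ∈′

-- Solving the recurrence

nCk*[n∸k]≡nC[1+k]*[1+k] : ∀ n k → (n C k) * (n ∸ k) ≡ (n C suc k) * suc k
nCk*[n∸k]≡nC[1+k]*[1+k] zero    zero    = refl
nCk*[n∸k]≡nC[1+k]*[1+k] zero    (suc k) = refl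
nCk*[n∸k]≡nC[1+k]*[1+k] (suc n) zero    = trans (+-identityʳ (suc n)) (sym (trans (*-identityʳ _) (nC1≡n (suc n))))
nCk*[n∸k]≡nC[1+k]*[1+k] (suc n) (suc k) with k <? n
... | no k≮n = begin
  (suc n C suc k) * (n ∸ k)               ≡⟨ cong ((suc n C suc k) *_) (m≤n⇒m∸n≡0 (≮⇒≥ k≮n)) ⟩
  (suc n C suc k) * 0                     ≡⟨ *-zeroʳ (suc n C suc k) ⟩
  0                                       ≡⟨ cong (_* suc (suc k)) (k>n⇒nCk≡0 (s≤s (s≤s (≮⇒≥ k≮n)))) ⟨
  (suc n C suc (suc k)) * suc (suc k)     ∎
  where open ≡-Reasoning
... | yes k<n = begin
  (suc n C suc k) * (n ∸ k)
    ≡⟨ cong (_* (n ∸ k)) (nCk+nC[k+1]≡[n+1]C[k+1] n k) ⟨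
  ((n C k) + (n C suc k)) * (n ∸ k)
    ≡⟨ *-distribʳ-+ (n ∸ k) (n C k) (n C suc k) ⟩
  (n C k) * (n ∸ k) + (n C suc k) * (n ∸ k)
    ≡⟨ cong₂ _+_ (nCk*[n∸k]≡nC[1+k]*[1+k] n k) (cong ((n C suc k) *_) n∸k≡1+[n∸1+k]) ⟩
  (n C suc k) * suc k + (n C suc k) * suc (n ∸ suc k)
    ≡⟨ regroup (n C suc k) k (n ∸ suc k) ⟩
  (n C suc k) * suc (suc k) + (n C suc k) * (n ∸ suc k)
    ≡⟨ cong ((n C suc k) * suc (suc k) +_) (nCk*[n∸k]≡nC[1+k]*[1+k] n (suc k)) ⟩
  (n C suc k) * suc (suc k) + (n C suc (suc k)) * suc (suc k)
    ≡⟨ *-distribʳ-+ (suc (suc k)) (n C suc k) (n C suc (suc k)) ⟨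
  ((n C suc k) + (n C suc (suc k))) * suc (suc k)
    ≡⟨ cong (_* suc (suc k)) (nCk+nC[k+1]≡[n+1]C[k+1] n (suc k)) ⟩
  (suc n C suc (suc k)) * suc (suc k)
    ∎
  where
  open ≡-Reasoning
  n∸k≡1+[n∸1+k] : n ∸ k ≡ suc (n ∸ suc k)
  n∸k≡1+[n∸1+k] = +-∸-assoc 1 k<n
  regroup : ∀ c k m → c * suc k + c * suc m ≡ c * suc (suc k) + c * m
  regroup = solve-∀

-- der n k is the number of derangements of [n] with k exceedances.
der : ℕ → ℕ → ℕ
der zero          zero    = 1
der zero          (suc k) = 0
der (suc n)       zero    = 0
der (suc zero)    (suc k) = 0
der (suc (suc n)) (suc k) = der (suc n) (suc k) * suc k + der (suc n) k * (suc n ∸ k) + der n k * suc n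

der-suc-suc : ∀ m k → der (suc m) (suc k) ≡ der m (suc k) * suc k + der m k * (m ∸ k) + der (pred m) k * m
der-suc-suc zero    k = sym (cong₂ _+_ (trans (cong (der 0 k *_) (0∸n≡0 k)) (*-zeroʳ (der 0 k))) (*-zeroʳ (der 0 k)))
der-suc-suc (suc m) k = refl

-- Choose the fixed points, then derange the rest.
permCount : ℕ → ℕ → ℕ → ℕ
permCount ℓ f k = (ℓ C f) * der (ℓ ∸ f) k

fixesZeroBound-permCount : ∀ ℓ f k →
  fixesZeroBound (permCount ℓ) f k + (ℓ C f) * der (suc ℓ ∸ f) k ≡ permCount (suc ℓ) f k
fixesZeroBound-permCount ℓ zero    k = refl
fixesZeroBound-permCount ℓ (suc f) k =
  trans (sym (*-distribʳ-+ (der (ℓ ∸ f) k) (ℓ C f) (ℓ C suc f)))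
        (cong (_* der (ℓ ∸ f) k) (nCk+nC[k+1]≡[n+1]C[k+1] ℓ f))

movesZeroBound-vanishes : ∀ ℓ b f k → (∀ k → b f k ≡ 0) → (∀ k → b (suc f) k ≡ 0) → movesZeroBound ℓ b f k ≡ 0
movesZeroBound-vanishes ℓ b f zero    _       _        = refl
movesZeroBound-vanishes ℓ b f (suc k) b[f]≡0 b[1+f]≡0 rewrite b[f]≡0 (suc k) | b[f]≡0 k | b[1+f]≡0 k = refl

movesZeroBound-permCount-+ : ∀ f m k → movesZeroBound (f + m) (permCount (f + m)) f k ≡ ((f + m) C f) * der (suc m) k
movesZeroBound-permCount-+ f m zero    = sym (*-zeroʳ ((f + m) C f))
movesZeroBound-permCount-+ f m (suc k) = begin
  c * der (f + m ∸ f) (suc k) * suc k + (c * der (f + m ∸ f) k * (f + m ∸ f ∸ k) + c′ * der (f + m ∸ suc f) k * suc f)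
    ≡⟨ cong₂ (λ x y → c * der x (suc k) * suc k + (c * der x k * (x ∸ k) + c′ * der y k * suc f)) (m+n∸m≡n f m)
             (trans (sym (pred[m∸n]≡m∸[1+n] (f + m) f)) (cong pred (m+n∸m≡n f m))) ⟩
  c * der m (suc k) * suc k + (c * der m k * (m ∸ k) + c′ * der (pred m) k * suc f)
    ≡⟨ cong (λ x → c * der m (suc k) * suc k + (c * der m k * (m ∸ k) + x)) absorb ⟩
  c * der m (suc k) * suc k + (c * der m k * (m ∸ k) + der (pred m) k * (c * m))
    ≡⟨ factor c (der m (suc k)) (der m k) (der (pred m) k) (suc k) (m ∸ k) m ⟩
  c * (der m (suc k) * suc k + der m k * (m ∸ k) + der (pred m) k * m)
    ≡⟨ cong (c *_) (der-suc-suc m k) ⟨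
  c * der (suc m) (suc k)
    ∎
  where
  open ≡-Reasoning
  c c′ : ℕ
  c  = (f + m) C f
  c′ = (f + m) C suc f
  absorb : c′ * der (pred m) k * suc f ≡ der (pred m) k * (c * m)
  absorb = trans (swap c′ (der (pred m) k) (suc f))
    (cong (der (pred m) k *_) (sym (trans (cong (c *_) (sym (m+n∸m≡n f m))) (nCk*[n∸k]≡nC[1+k]*[1+k] (f + m) f))))
    where
    swap : ∀ x y z → x * y * z ≡ y * (x * z)
    swap = solve-∀
  factor : ∀ c a b d s t u → c * a * s + (c * b * t + d * (c * u)) ≡ c * (a * s + b * t + d * u)
  factor = solve-∀

movesZeroBound-permCount : ∀ ℓ f k → movesZeroBound ℓ (permCount ℓ) f k ≡ (ℓ C f) * der (suc ℓ ∸ f) k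
movesZeroBound-permCount ℓ f k with f ≤? ℓ
... | no f≰ℓ = trans
  (movesZeroBound-vanishes ℓ (permCount ℓ) f k (λ k → cong (_* der (ℓ ∸ f) k) (k>n⇒nCk≡0 (≰⇒> f≰ℓ)))
                                               (λ k → cong (_* der (ℓ ∸ suc f) k) (k>n⇒nCk≡0 (m<n⇒m<1+n (≰⇒> f≰ℓ)))))
  (sym (cong (_* der (suc ℓ ∸ f) k) (k>n⇒nCk≡0 (≰⇒> f≰ℓ))))
... | yes f≤ℓ with m , refl ← m≤n⇒∃[o]m+o≡n f≤ℓ =
  trans (movesZeroBound-permCount-+ f m k)
        (cong (λ x → ((f + m) C f) * der x k) (sym (trans (+-∸-assoc 1 (m≤m+n f m)) (cong suc (m+n∸m≡n f m)))))

permCount-deletion : ∀ ℓ f k →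
  fixesZeroBound (permCount ℓ) f k + movesZeroBound ℓ (permCount ℓ) f k ≡ permCount (suc ℓ) f k
permCount-deletion ℓ f k = trans (cong (fixesZeroBound (permCount ℓ) f k +_) (movesZeroBound-permCount ℓ f k))
                                 (fixesZeroBound-permCount ℓ f k)

-- Bounds on der

der-vanishes : ∀ {n k} → suc n ≤ k → der (suc n) k ≡ 0
der-vanishes {zero}  {suc k} _ = refl
der-vanishes {suc n} {suc k} (s≤s 1+n≤k) =
  cong₂ _+_ (cong₂ _+_ (cong (_* suc k) (der-vanishes (m≤n⇒m≤1+n 1+n≤k)))
                       (cong (_* (suc n ∸ k)) (der-vanishes 1+n≤k)))
            (cong (_* suc n) (below n 1+n≤k))
  where
  below : ∀ n {k} → n < k → der n k ≡ 0
  below zero    {suc k} _   = refl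
  below (suc n)         n<k = der-vanishes (<⇒≤ n<k)

der-one : ∀ n → der (suc (suc n)) 1 ≡ 1
der-one zero    = refl
der-one (suc n) = cong (λ x → x * 1 + 0 + 0) (der-one n)

der-subdiagonal : ∀ n → der (suc (suc n)) (suc n) ≡ 1
der-subdiagonal zero    = refl
der-subdiagonal (suc n) =
  cong₂ _+_ (cong₂ _+_ (cong (_* suc (suc n)) (der-vanishes {suc n} ≤-refl))
                       (cong₂ _*_ (der-subdiagonal n) (m+n∸n≡m 1 n)))
            (cong (_* suc (suc n)) (der-vanishes {n} ≤-refl))

B^[1+n]+2[1+n]B^n≤[B+2]^[1+n] : ∀ B n → B ^ suc n + 2 * (suc n * B ^ n) ≤ (B + 2) ^ suc n
B^[1+n]+2[1+n]B^n≤[B+2]^[1+n] B zero    = ≤-reflexive (base B)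
  where
  base : ∀ B → B * 1 + 2 * (1 * 1) ≡ (B + 2) * 1
  base = solve-∀
B^[1+n]+2[1+n]B^n≤[B+2]^[1+n] B (suc n) = begin
  B * (B * B ^ n) + 2 * (suc (suc n) * (B * B ^ n))
    ≤⟨ m≤m+n _ (4 * (suc n * B ^ n)) ⟩
  B * (B * B ^ n) + 2 * (suc (suc n) * (B * B ^ n)) + 4 * (suc n * B ^ n)
    ≡⟨ expand B n (B ^ n) ⟩
  (B + 2) * (B * B ^ n + 2 * (suc n * B ^ n))
    ≤⟨ *-monoʳ-≤ (B + 2) (B^[1+n]+2[1+n]B^n≤[B+2]^[1+n] B n) ⟩
  (B + 2) * (B + 2) ^ suc n
    ∎
  where
  open ≤-Reasoning
  expand : ∀ B n x → B * (B * x) + 2 * (suc (suc n) * (B * x)) + 4 * (suc n * x) ≡ (B + 2) * (B * x + 2 * (suc n * x))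
  expand = solve-∀

der-step-bound : ∀ j n → (2 * suc j + 3) ^ suc n * suc j + ((2 * j + 3) ^ suc n * suc n + (2 * j + 3) ^ n * suc n)
                         ≤ (2 * suc j + 3) ^ suc (suc n)
der-step-bound j n = begin
  big * suc j + ((2 * j + 3) * small * suc n + small * suc n)
    ≡⟨ cong (big * suc j +_) (halve j n small) ⟩
  big * suc j + (j + 2) * (2 * (suc n * small))
    ≤⟨ +-monoʳ-≤ (big * suc j) (*-monoʳ-≤ (j + 2) twice-bound) ⟩
  big * suc j + (j + 2) * big
    ≡⟨ collect big j ⟩
  (2 * j + 3) * big
    ≤⟨ *-monoˡ-≤ big (2j+3≤2[1+j]+3 j) ⟩
  (2 * suc j + 3) * big
    ∎
  where
  open ≤-Reasoning
  big small : ℕ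
  big   = (2 * suc j + 3) ^ suc n
  small = (2 * j + 3) ^ n
  twice-bound : 2 * (suc n * small) ≤ big
  twice-bound = subst (λ x → 2 * (suc n * small) ≤ x ^ suc n) (shift j)
    (≤-trans (m≤n+m (2 * (suc n * small)) ((2 * j + 3) ^ suc n)) (B^[1+n]+2[1+n]B^n≤[B+2]^[1+n] (2 * j + 3) n))
    where
    shift : ∀ j → 2 * j + 3 + 2 ≡ 2 * suc j + 3
    shift = solve-∀
  halve : ∀ j n b → (2 * j + 3) * b * suc n + b * suc n ≡ (j + 2) * (2 * (suc n * b))
  halve = solve-∀
  collect : ∀ A j → A * suc j + (j + 2) * A ≡ (2 * j + 3) * A
  collect = solve-∀
  2j+3≤2[1+j]+3 : ∀ j → 2 * j + 3 ≤ 2 * suc j + 3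
  2j+3≤2[1+j]+3 j = +-monoˡ-≤ 3 (*-monoʳ-≤ 2 (n≤1+n j))

der≤[2k+3]^n : ∀ n k → der n k ≤ (2 * k + 3) ^ n
der≤[2k+3]^n zero          zero    = ≤-refl
der≤[2k+3]^n zero          (suc k) = z≤n
der≤[2k+3]^n (suc n)       zero    = z≤n
der≤[2k+3]^n (suc zero)    (suc k) = z≤n
der≤[2k+3]^n (suc (suc n)) (suc k) = begin
  der (suc n) (suc k) * suc k + der (suc n) k * (suc n ∸ k) + der n k * suc n
    ≤⟨ +-mono-≤ (+-mono-≤ (*-monoˡ-≤ (suc k) (der≤[2k+3]^n (suc n) (suc k)))
                          (*-mono-≤ (der≤[2k+3]^n (suc n) k) (m∸n≤m (suc n) k)))
                (*-monoˡ-≤ (suc n) (der≤[2k+3]^n n k)) ⟩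
  (2 * suc k + 3) ^ suc n * suc k + (2 * k + 3) ^ suc n * suc n + (2 * k + 3) ^ n * suc n
    ≡⟨ +-assoc ((2 * suc k + 3) ^ suc n * suc k) _ _ ⟩
  (2 * suc k + 3) ^ suc n * suc k + ((2 * k + 3) ^ suc n * suc n + (2 * k + 3) ^ n * suc n)
    ≤⟨ der-step-bound k n ⟩
  (2 * suc k + 3) ^ suc (suc n)
    ∎
  where open ≤-Reasoning

der≤[2[n∸k]+3]^n : ∀ n k → der n k ≤ (2 * (n ∸ k) + 3) ^ n
der≤[2[n∸k]+3]^n zero          zero    = ≤-refl
der≤[2[n∸k]+3]^n zero          (suc k) = z≤n
der≤[2[n∸k]+3]^n (suc n)       zero    = z≤n
der≤[2[n∸k]+3]^n (suc zero)    (suc k) = z≤n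
der≤[2[n∸k]+3]^n (suc (suc n)) (suc k) =
  step (k ≤? n) (der≤[2[n∸k]+3]^n (suc n) (suc k)) (der≤[2[n∸k]+3]^n (suc n) k) (der≤[2[n∸k]+3]^n n k)
  where
  open ≤-Reasoning
  step : Dec (k ≤ n) →
         der (suc n) (suc k) ≤ (2 * (n ∸ k) + 3) ^ suc n →
         der (suc n) k ≤ (2 * (suc n ∸ k) + 3) ^ suc n →
         der n k ≤ (2 * (n ∸ k) + 3) ^ n →
         der (suc (suc n)) (suc k) ≤ (2 * (suc n ∸ k) + 3) ^ suc (suc n)
  step (no k≰n) _ _ _ = ≤-trans (≤-reflexive (der-vanishes {suc n} (s≤s (≰⇒> k≰n)))) z≤n
  step (yes k≤n) bound₁ bound₂ bound₃ = begin
    der (suc n) (suc k) * suc k + der (suc n) k * (suc n ∸ k) + der n k * suc n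
      ≤⟨ +-mono-≤ (+-mono-≤ (*-mono-≤ bound₁ (s≤s k≤n)) (*-monoˡ-≤ (suc n ∸ k) bound₂)) (*-monoˡ-≤ (suc n) bound₃) ⟩
    base ^ suc n * suc n + (2 * (suc n ∸ k) + 3) ^ suc n * (suc n ∸ k) + base ^ n * suc n
      ≡⟨ cong (λ x → base ^ suc n * suc n + (2 * x + 3) ^ suc n * x + base ^ n * suc n) 1+n∸k≡1+j ⟩
    base ^ suc n * suc n + big * suc j + base ^ n * suc n
      ≡⟨ rotate (base ^ suc n * suc n) (big * suc j) (base ^ n * suc n) ⟩
    big * suc j + (base ^ suc n * suc n + base ^ n * suc n)
      ≤⟨ der-step-bound j n ⟩
    (2 * suc j + 3) ^ suc (suc n)
      ≡⟨ cong (λ x → (2 * x + 3) ^ suc (suc n)) 1+n∸k≡1+j ⟨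
    (2 * (suc n ∸ k) + 3) ^ suc (suc n)
      ∎
    where
    j base big : ℕ
    j    = n ∸ k
    base = 2 * j + 3
    big  = (2 * suc j + 3) ^ suc n
    1+n∸k≡1+j : suc n ∸ k ≡ suc j
    1+n∸k≡1+j = +-∸-assoc 1 k≤n
    rotate : ∀ x y z → x + y + z ≡ y + (x + z)
    rotate = solve-∀

der≤θ : ∀ {n} k → 2 ≤ n → der n k ≤ θ n k
der≤θ {suc zero}    k (s≤s ())
der≤θ {suc (suc n)} k _ with k ≡ᵇ 1 in k≡ᵇ1
... | true rewrite ≡ᵇ⇒≡ k 1 (subst T (sym k≡ᵇ1) tt) = ≤-reflexive (der-one n)
... | false with k ≡ᵇ suc n in k≡ᵇ1+n
...   | true rewrite ≡ᵇ⇒≡ k (suc n) (subst T (sym k≡ᵇ1+n) tt) = ≤-reflexive (der-subdiagonal n)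
...   | false with 2 * k <ᵇ suc (suc n)
...     | true  = der≤[2k+3]^n (suc (suc n)) k
...     | false = ≤-trans (der≤[2[n∸k]+3]^n (suc (suc n)) k) (^-monoˡ-≤ (suc (suc n)) (2[m∸k]+3≤2m∸2k+5 (suc (suc n))))
  where
  2[m∸k]+3≤2m∸2k+5 : ∀ m → 2 * (m ∸ k) + 3 ≤ 2 * m ∸ 2 * k + 5
  2[m∸k]+3≤2m∸2k+5 m = ≤-trans (≤-reflexive (cong (_+ 3) (*-distribˡ-∸ 2 m k))) (+-monoʳ-≤ (2 * m ∸ 2 * k) (s≤s (s≤s (s≤s z≤n))))

permWith≤permCount : ∀ ℓ f k → ∣ PermWith {ℓ} f k ∣≤ permCount ℓ f k
permWith≤permCount zero    zero    zero    = ∣∣≤-mono (λ { {[]} _ → refl }) ≤-refl (∣∣≤-singleton [])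
permWith≤permCount zero    (suc f) k       = ∣∣≤-empty λ { {[]} (_ , () , _) }
permWith≤permCount zero    zero    (suc k) = ∣∣≤-empty λ { {[]} (_ , _ , ()) }
permWith≤permCount (suc ℓ) f       k       =
  ∣∣≤-mono id (≤-reflexive (permCount-deletion ℓ f k))
           (DeleteZero.deletion-step (permCount ℓ) (permWith≤permCount ℓ) f k)

lemma11 : (ℓ n k : ℕ) → 2 ≤ n → n ≤ ℓ → 1 ≤ k → k ≤ n ∸ 1 →
          (xs : List (Vec (Fin ℓ) ℓ)) → Unique xs → All (InS ℓ n k) xs →
          length xs ≤ (ℓ C n) * θ n k
lemma11 ℓ n k 2≤n n≤ℓ _ _ xs unique σs∈S = begin
  length xs              ≤⟨ permWith≤permCount ℓ (ℓ ∸ n) k xs unique σs∈S ⟩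
  permCount ℓ (ℓ ∸ n) k  ≡⟨ cong₂ _*_ (sym (nCk≡nC[n∸k] n≤ℓ)) (cong (λ m → der m k) (m∸[m∸n]≡n n≤ℓ)) ⟩
  (ℓ C n) * der n k      ≤⟨ *-monoʳ-≤ (ℓ C n) (der≤θ k 2≤n) ⟩
  (ℓ C n) * θ n k        ∎
  where open ≤-Reasoning
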